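{- Let $p$ be a prime, let $K\subset\mathbb{Q}_p$ be a field with $[K:\mathbb{Q}]=2$, let $z\in K$ satisfy condition (H) with $K=\mathbb{Q}(z)$, and let $\epsilon\in\{ -1,1\}$. For every $q\in\mathbb{Q}$ with $\mathrm{ord}_p(qz)>0$, the element $qz$ has a periodic expansion under the map $T=T_{\epsilon,z}$ defined in the context, i.e. $T^{m_1}(qz)=T^{m_2}(qz)$ for some integers $0\le m_1<m_2$.
   Context: Notation: For $\beta\in\mathbb{Q}_p\setminus\{0\}$ write $\beta=\sum_{n\in\mathbb{Z}}c_np^n$ with digits $c_n\in\{0,1,\dots,p-1\}$; $\mathrm{ord}_p(\beta)=\min\{n: c_n\neq 0\}$ ($\mathrm{ord}_p(0)=\infty$), $\omega_p(\beta):=c_0$ ($\omega_p(0)=0$), and $\langle\beta\rangle_p:=\sum_{n\ge 1}c_np^n$ ($\langle 0\rangle_p=0$). Condition (H): an element $\beta\in\mathbb{Q}_p$, algebraic over $\mathbb{Q}$, with $\beta\notin\mathbb{Q}$ and $\beta\in p\mathbb{Z}_p$, satisfies (H) if its minimal polynomial over $\mathbb{Q}$ is $x^n+a_1x^{n-1}+\dots+a_n$ with all $a_i\in\mathbb{Z}_p\cap\mathbb{Q}$, $\mathrm{ord}_p(a_{n-1})=0$ and $\mathrm{ord}_p(a_n)>0$. The map $T=T_{\epsilon,z}:K\to K$: for $\alpha\in K$, put $g=\frac{\epsilon p^{\mathrm{ord}_p(\alpha)}}{\alpha}-\omega_p\!\left(\frac{\epsilon p^{\mathrm{ord}_p(\alpha)}}{\alpha}\right)$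 if $\alpha\neq0$ and $g=0$ if $\alpha=0$. Write uniquely $g=a_0+a_1z$ with $a_0,a_1\in\mathbb{Q}$, let $a'$ be the largest positive integer coprime to $p$ dividing the numerator of $a_1$ (with $a'=1$ if $a_1=0$), and set $T(\alpha):=\frac{g}{a'}-\left\langle\frac{a_0}{a'}\right\rangle_p$. -}

module Defs where

open import Data.Nat as ℕ using (ℕ; zero; suc; NonZero)
open import Data.Nat.Properties using (m^n≢0)
open import Data.Nat.Primality using (Prime; prime⇒nonZero)
open import Data.Nat.Divisibility using (_∣_)
open import Data.Nat.Coprimality using (Coprime)
open import Data.Integer as ℤ using (ℤ; +_; -[1+_])
open import Data.Rational as ℚ using (ℚ; ↥_; ↧ₙ_; 0ℚ; 1ℚ; _+_; _*_; _-_)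
open import Data.Product using (_×_; _,_; proj₁; proj₂; ∃; ∃-syntax)
open import Data.Sum using (_⊎_)
open import Relation.Nullary using (¬_)
open import Relation.Binary.PropositionalEquality using (_≡_; _≢_)

ℕ→ℚ : ℕ → ℚ
ℕ→ℚ n = + n ℚ./ 1

-- Elements of K = ℚ(z) are represented by their coordinates (a , b)
-- in the ℚ-basis {1 , z}: the pair (a , b) stands for a + b z.
K : Set
K = ℚ × ℚ

0K : K
0K = (0ℚ , 0ℚ)

_-K_ : K → K → K
(a , b) -K (c , e) = (a - c , b - e)

-- Data fixed throughout:
--   p  : a prime,
--   a₁ a₂ : the coefficients of the minimal polynomial x² + a₁ x + a₂ of z,
--   d  : the p-adic digit sequence of z ∈ ℚ_p (z = Σ_{n ≥ 0} d n pⁿ),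
--   ε  : the sign ε ∈ {-1, 1}.
module PAdic (p : ℕ) (pr : Prime p) (a₁ a₂ : ℚ) (d : ℕ → ℕ) (ε : ℚ) where

  private instance
    p≢0 : NonZero p
    p≢0 = prime⇒nonZero pr

  pPow : ℤ → ℚ
  pPow (+ n)    = ℕ→ℚ (p ℕ.^ n)
  pPow -[1+ n ] = ℚ._/_ (+ 1) (p ℕ.^ suc n) {{m^n≢0 p (suc n)}}

  IntegralQ : ℚ → Set
  IntegralQ r = ¬ (p ∣ ↧ₙ r)

  -- r ∈ pᵐ ℤ_(p), i.e. ord_p(r) ≥ m  (true for r = 0)
  InPQ : ℤ → ℚ → Set
  InPQ m r = IntegralQ (r * pPow (ℤ.- m))

  f : ℚ → ℚ
  f x = x * x + a₁ * x + a₂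

  -- Condition (H) for z with minimal polynomial x² + a₁ x + a₂ (degree 2):
  -- a₁, a₂ ∈ ℤ_p ∩ ℚ, ord_p(a₁) = 0, ord_p(a₂) > 0, and the polynomial is
  -- the minimal polynomial of an irrational element, i.e. (being quadratic)
  -- it has no rational root.
  CondH : Set
  CondH = IntegralQ a₁ × IntegralQ a₂ × ¬ InPQ (+ 1) a₁ × InPQ (+ 1) a₂
        × (∀ (r : ℚ) → f r ≢ 0ℚ)

  zTrunc : ℕ → ℕ
  zTrunc zero    = 0
  zTrunc (suc k) = zTrunc k ℕ.+ d k ℕ.* p ℕ.^ k

  -- d is the digit sequence of a root z ∈ pℤ_p of f:
  -- digits in {0,…,p-1}, d 0 = 0 (so z ∈ pℤ_p), and f(z_k) ≡ 0 mod pᵏ for all k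
  -- (hence f(z) = 0 in ℚ_p).
  RootDigits : Set
  RootDigits = (∀ n → d n ℕ.< p) × d 0 ≡ 0
             × (∀ k → InPQ (+ k) (f (ℕ→ℚ (zTrunc k))))

  -- rational approximations a + b z_k of the element a + b z ∈ K ⊂ ℚ_p
  approx : K → ℕ → ℚ
  approx (a , b) k = a + b * ℕ→ℚ (zTrunc k)

  -- α ∈ pᵐ ℤ_p (i.e. ord_p(α) ≥ m), via: a + b z_k ∈ pᵐ ℤ_(p) for all large k
  InP : ℤ → K → Set
  InP m α = ∃[ N ] (∀ k → N ℕ.≤ k → InPQ m (approx α k))

  IsOrd : K → ℤ → Set
  IsOrd α v = InP v α × ¬ InP (v ℤ.+ + 1) α

  -- multiplication in K, using z² = - a₁ z - a₂
  _*K_ : K → K → K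
  (a , b) *K (c , e) = (a * c - b * e * a₂ , a * e + b * c - b * e * a₁)

  -- ω_p(β) = c for β ∈ ℤ_p ∩ K: c ∈ {0,…,p-1} and β - c ∈ pℤ_p
  IsDigit0 : K → ℕ → Set
  IsDigit0 β c = c ℕ.< p × InP (+ 1) (β -K (ℕ→ℚ c , 0ℚ))

  IsA' : ℚ → ℕ → Set
  IsA' g₁ a' = (g₁ ≡ 0ℚ × a' ≡ 1)
             ⊎ (g₁ ≢ 0ℚ × 1 ℕ.≤ a' × Coprime a' p × a' ∣ ℤ.∣ ↥ g₁ ∣
                × (∀ m → 1 ℕ.≤ m → Coprime m p → m ∣ ℤ.∣ ↥ g₁ ∣ → m ℕ.≤ a'))

  -- for x ∈ ℚ with digits x = Σ cₙ pⁿ: s = Σ_{n ≤ 0} cₙ pⁿ = x - ⟨x⟩_p.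
  -- Characterised by: 0 ≤ s < p, the denominator of s is a power of p,
  -- and x - s ∈ pℤ_(p).
  LowPart : ℚ → ℚ → Set
  LowPart x s = 0ℚ ℚ.≤ s × s ℚ.< ℕ→ℚ p
              × (∃[ e ] ↧ₙ (s * pPow (+ e)) ≡ 1)
              × InPQ (+ 1) (x - s)

  -- The graph of T = T_{ε,z}:  TRel α β  means  T(α) = β.
  -- For α ≠ 0:  γ = ε p^{ord α}/α,  c = ω_p(γ),  g = γ - c = (g₀ , g₁),
  -- a' as above,  s = g₀/a' - ⟨g₀/a'⟩_p,  and T(α) = g/a' - ⟨g₀/a'⟩_p = s + (g₁/a') z.
  TRel : K → K → Set
  TRel α β =
      (α ≡ 0K × β ≡ 0K)
    ⊎ (α ≢ 0K ×
       ∃[ v ] ∃[ γ ] ∃[ c ] ∃[ a' ] ∃[ ia ] ∃[ s ]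
         ( IsOrd α v
         × γ *K α ≡ (ε * pPow v , 0ℚ)
         × IsDigit0 γ c
         × IsA' (proj₂ (γ -K (ℕ→ℚ c , 0ℚ))) a'
         × ia * ℕ→ℚ a' ≡ 1ℚ
         × LowPart (proj₁ (γ -K (ℕ→ℚ c , 0ℚ)) * ia) s
         × β ≡ (s , proj₂ (γ -K (ℕ→ℚ c , 0ℚ)) * ia)))

module Submission where

open import Defs
open import Data.Nat as ℕ using (ℕ; zero; suc; NonZero; _<_; _≤_)
import Data.Nat.Properties as ℕP
open import Data.Nat.Primality using (Prime; prime⇒nonZero; prime⇒nonTrivial; prime⇒irreducible; euclidsLemma)
open import Data.Nat.Divisibility using (_∣_; divides; _∣?_; _∣0; ∣-trans; ∣-refl; ∣1⇒≡1; ∣⇒≤; m∣m*n; n∣m*n; ∣m∣n⇒∣m+n)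
open import Data.Nat.Coprimality as Coprimality using (Coprime; coprime-divisor)
import Data.Nat.GCD as GCD
open import Data.Nat.Induction using (<-wellFounded)
open import Induction.WellFounded using (Acc; acc)
open import Data.Integer as ℤ using (ℤ; +_; -[1+_])
import Data.Integer.Properties as ℤP
open import Data.Rational as ℚ using (ℚ; mkℚ; ↥_; ↧_; ↧ₙ_; 0ℚ; 1ℚ; _+_; _*_; _-_; -_)
import Data.Rational.Properties as ℚP
import Data.Rational.Unnormalised as ℚᵘ
import Data.Rational.Unnormalised.Properties as ℚᵘP
open import Data.Rational.Solver using (module +-*-Solver)
open +-*-Solver using (solve; _:=_; _:+_; _:-_; _:*_; :-_; con)
open import Data.Fin as Fin using (Fin; toℕ; fromℕ<; combine; remQuot)
import Data.Fin.Properties as FinP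
open import Data.Product using (∃-syntax; _×_; _,_; proj₁; proj₂)
open import Data.Sum using (_⊎_; inj₁; inj₂; [_,_]′)
open import Data.Empty using (⊥-elim)
open import Relation.Nullary using (¬_; Dec; yes; no)
open import Relation.Binary.PropositionalEquality

-- Let α = t z with t ∈ ℚ, t ≠ 0, and v = ord_p(t z).  Since z (z + a₁) = -a₂
-- and z + a₁ is a p-adic unit (condition (H)), ord_p(t a₂) = v, so U = pᵛ / (t a₂)
-- is a p-adic unit.  Computing T(α) coordinatewise in the basis {1, z}: the
-- z-coefficient of γ = ε pᵛ/α is -ε U, its constant part is in pℤ_p and hence the
-- digit part vanishes, and a' = |num U|; so T(t z) = (±1/den U) z again lies on the
-- line ℚ z.  If moreover t = ±1/D₀, then U a₂ = ±D₀ pᵛ forces den U ∣ num a₂.  Hence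
-- from the second step on the orbit of q z stays in the finite set of points
-- (±1/D) z with D ∣ num a₂, and by the pigeonhole principle it repeats a value.

ι : ℤ → ℚ
ι i = i ℚ./ 1

↥-ι : ∀ i → ↥ ι i ≡ i
↥-ι i = trans (sym (ℤP.*-identityʳ _))
  (trans (cong (λ g → ↥ ι i ℤ.* + g) (sym (GCD.gcd-zeroʳ ℤ.∣ i ∣))) (ℚP.↥-/ i 1))

↧-ι : ∀ i → ↧ ι i ≡ + 1
↧-ι i = trans (sym (ℤP.*-identityʳ _))
  (trans (cong (λ g → ↧ ι i ℤ.* + g) (sym (GCD.gcd-zeroʳ ℤ.∣ i ∣))) (ℚP.↧-/ i 1))

ι-injective : ∀ i j → ι i ≡ ι j → i ≡ j
ι-injective i j e = trans (sym (↥-ι i)) (trans (cong ↥_ e) (↥-ι j))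

*-by-cross : ∀ r s t → (↥ r ℤ.* ↥ s) ℤ.* ↧ t ≡ ↥ t ℤ.* (↧ r ℤ.* ↧ s) → r * s ≡ t
*-by-cross r@(mkℚ _ _ _) s@(mkℚ _ _ _) t@(mkℚ _ _ _) e =
  ℚP.toℚᵘ-injective (ℚᵘP.≃-trans (ℚP.toℚᵘ-homo-* r s) (ℚᵘ.*≡* e))

*-cross : ∀ r s t → r * s ≡ t → (↥ r ℤ.* ↥ s) ℤ.* ↧ t ≡ ↥ t ℤ.* (↧ r ℤ.* ↧ s)
*-cross r@(mkℚ _ _ _) s@(mkℚ _ _ _) t@(mkℚ _ _ _) e
  with ℚᵘP.≃-trans (ℚᵘP.≃-sym (ℚP.toℚᵘ-homo-* r s)) (ℚP.toℚᵘ-cong e)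
... | ℚᵘ.*≡* q = q

+-by-cross : ∀ r s t → (↥ r ℤ.* ↧ s ℤ.+ ↥ s ℤ.* ↧ r) ℤ.* ↧ t ≡ ↥ t ℤ.* (↧ r ℤ.* ↧ s) → r + s ≡ t
+-by-cross r@(mkℚ _ _ _) s@(mkℚ _ _ _) t@(mkℚ _ _ _) e =
  ℚP.toℚᵘ-injective (ℚᵘP.≃-trans (ℚP.toℚᵘ-homo-+ r s) (ℚᵘ.*≡* e))

ι-* : ∀ i j → ι (i ℤ.* j) ≡ ι i * ι j
ι-* i j = sym (*-by-cross (ι i) (ι j) (ι (i ℤ.* j))
  (cross (↥-ι i) (↥-ι j) (↧-ι (i ℤ.* j)) (↥-ι (i ℤ.* j)) (↧-ι i) (↧-ι j)))
  where
  cross : ∀ {A B C D E F} → A ≡ i → B ≡ j → C ≡ + 1 → D ≡ i ℤ.* j → E ≡ + 1 → F ≡ + 1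
        → (A ℤ.* B) ℤ.* C ≡ D ℤ.* (E ℤ.* F)
  cross refl refl refl refl refl refl = refl

ι-+ : ∀ i j → ι (i ℤ.+ j) ≡ ι i + ι j
ι-+ i j = sym (+-by-cross (ι i) (ι j) (ι (i ℤ.+ j))
  (cross (↥-ι i) (↥-ι j) (↧-ι (i ℤ.+ j)) (↥-ι (i ℤ.+ j)) (↧-ι i) (↧-ι j)))
  where
  cross : ∀ {A B C D E F} → A ≡ i → B ≡ j → C ≡ + 1 → D ≡ i ℤ.+ j → E ≡ + 1 → F ≡ + 1
        → (A ℤ.* F ℤ.+ B ℤ.* E) ℤ.* C ≡ D ℤ.* (E ℤ.* F)
  cross refl refl refl refl refl refl rewrite ℤP.*-identityʳ i | ℤP.*-identityʳ j = refl

ℕ→ℚ-* : ∀ a b → ℕ→ℚ (a ℕ.* b) ≡ ℕ→ℚ a * ℕ→ℚ b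
ℕ→ℚ-* a b = trans (cong ι (sym (ℤP.+◃n≡+n (a ℕ.* b)))) (ι-* (+ a) (+ b))

cross-ι : ∀ a b → ↥ ι a ℤ.* ↧ ι b ≡ a
cross-ι a b = trans (cong₂ ℤ._*_ (↥-ι a) (↧-ι b)) (ℤP.*-identityʳ a)

ι-≤ : ∀ i j → ι i ℚ.≤ ι j → i ℤ.≤ j
ι-≤ i j le = subst₂ ℤ._≤_ (cross-ι i j) (cross-ι j i) (ℚP.drop-*≤* le)

ι-< : ∀ i j → ι i ℚ.< ι j → i ℤ.< j
ι-< i j lt = subst₂ ℤ._<_ (cross-ι i j) (cross-ι j i) (ℚP.drop-*<* lt)

clear-denominator : ∀ r → r * ι (↧ r) ≡ ι (↥ r)
clear-denominator r = *-by-cross r (ι (↧ r)) (ι (↥ r)) cross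
  where
  cross : (↥ r ℤ.* ↥ ι (↧ r)) ℤ.* ↧ ι (↥ r) ≡ ↥ ι (↥ r) ℤ.* (↧ r ℤ.* ↧ ι (↧ r))
  cross = cross′ (↥-ι (↧ r)) (↧-ι (↥ r)) (↥-ι (↥ r)) (↧-ι (↧ r))
    where
    cross′ : ∀ {A B C D} → A ≡ ↧ r → B ≡ + 1 → C ≡ ↥ r → D ≡ + 1
           → (↥ r ℤ.* A) ℤ.* B ≡ C ℤ.* (↧ r ℤ.* D)
    cross′ refl refl refl refl = trans (ℤP.*-identityʳ _) (cong (↥ r ℤ.*_) (sym (ℤP.*-identityʳ _)))

denominator-1 : ∀ r → ↧ₙ r ≡ 1 → r ≡ ι (↥ r)
denominator-1 r@(mkℚ _ zero _) refl = trans (sym (ℚP.*-identityʳ r)) (clear-denominator r)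

numerator-coprime : ∀ r → Coprime ℤ.∣ ↥ r ∣ (↧ₙ r)
numerator-coprime (mkℚ _ _ c) = Coprimality.recompute c

denominator-∣ : ∀ r b a → r * ι b ≡ ι a → ↧ₙ r ∣ ℤ.∣ b ∣
denominator-∣ r b a e =
  coprime-divisor (Coprimality.sym (numerator-coprime r)) (divides ℤ.∣ a ∣ abs-eq)
  where
  int-eq : ↥ r ℤ.* b ≡ a ℤ.* ↧ r
  int-eq = cancel-units (↥-ι b) (↧-ι b) (↥-ι a) (↧-ι a) (*-cross r (ι b) (ι a) e)
    where
    cancel-units : ∀ {B B′ A A′} → B ≡ b → B′ ≡ + 1 → A ≡ a → A′ ≡ + 1
                 → (↥ r ℤ.* B) ℤ.* A′ ≡ A ℤ.* (↧ r ℤ.* B′) → ↥ r ℤ.* b ≡ a ℤ.* ↧ r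
    cancel-units refl refl refl refl q =
      trans (sym (ℤP.*-identityʳ _)) (trans q (cong (a ℤ.*_) (ℤP.*-identityʳ _)))
  abs-eq : ℤ.∣ ↥ r ∣ ℕ.* ℤ.∣ b ∣ ≡ ℤ.∣ a ∣ ℕ.* ↧ₙ r
  abs-eq = trans (sym (ℤP.abs-* (↥ r) b)) (trans (cong ℤ.∣_∣ int-eq) (ℤP.abs-* a (↧ r)))

ℕ→ℚ-inverse : ∀ m .{{_ : NonZero m}} → ℕ→ℚ m * (+ 1 ℚ./ m) ≡ 1ℚ
ℕ→ℚ-inverse m = *-by-cross (ℕ→ℚ m) (+ 1 ℚ./ m) 1ℚ cross
  where
  ↥1/m : ↥ (+ 1 ℚ./ m) ≡ + 1
  ↥1/m = trans (sym (ℤP.*-identityʳ _))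
    (trans (cong (λ g → ↥ (+ 1 ℚ./ m) ℤ.* + g) (sym (GCD.gcd-zeroˡ m))) (ℚP.↥-/ (+ 1) m))
  ↧1/m : ↧ (+ 1 ℚ./ m) ≡ + m
  ↧1/m = trans (sym (ℤP.*-identityʳ _))
    (trans (cong (λ g → ↧ (+ 1 ℚ./ m) ℤ.* + g) (sym (GCD.gcd-zeroˡ m))) (ℚP.↧-/ (+ 1) m))
  cross : (↥ ℕ→ℚ m ℤ.* ↥ (+ 1 ℚ./ m)) ℤ.* + 1 ≡ + 1 ℤ.* (↧ ℕ→ℚ m ℤ.* ↧ (+ 1 ℚ./ m))
  cross = cross′ (↥-ι (+ m)) ↥1/m (↧-ι (+ m)) ↧1/m
    where
    cross′ : ∀ {A B C D} → A ≡ + m → B ≡ + 1 → C ≡ + 1 → D ≡ + m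
           → (A ℤ.* B) ℤ.* + 1 ≡ + 1 ℤ.* (C ℤ.* D)
    cross′ refl refl refl refl = trans (ℤP.*-identityʳ _)
      (trans (ℤP.*-identityʳ _) (sym (trans (ℤP.*-identityˡ _) (ℤP.*-identityˡ _))))

inverse-unique : ∀ a b n → a * n ≡ 1ℚ → b * n ≡ 1ℚ → a ≡ b
inverse-unique a b n an≡1 bn≡1 = begin
  a               ≡⟨ sym (ℚP.*-identityʳ a) ⟩
  a * 1ℚ          ≡⟨ cong (a *_) (sym bn≡1) ⟩
  a * (b * n)     ≡⟨ solve 3 (λ a b n → a :* (b :* n) := a :* n :* b) refl a b n ⟩
  a * n * b       ≡⟨ cong (_* b) an≡1 ⟩
  1ℚ * b          ≡⟨ ℚP.*-identityˡ b ⟩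
  b               ∎
  where open ≡-Reasoning

neg-as-* : ∀ r → - r ≡ ι -[1+ 0 ] * r
neg-as-* = solve 1 (λ r → :- r := (:- con 1ℚ) :* r) refl

multiple-below : ∀ j n → 0ℚ ℚ.≤ ι (j ℤ.* + suc n) → ι (j ℤ.* + suc n) ℚ.< ι (+ suc n) → j ≡ + 0
multiple-below j n 0≤jn jn<n = below-one j
  (ℤP.*-cancelʳ-≤-pos (+ 0) j (+ suc n) (ι-≤ (+ 0) (j ℤ.* + suc n) 0≤jn))
  (ℤP.*-cancelʳ-<-nonNeg {j} {+ 1} (+ suc n)
    (subst (j ℤ.* + suc n ℤ.<_) (sym (ℤP.*-identityˡ (+ suc n))) (ι-< (j ℤ.* + suc n) (+ suc n) jn<n)))
  where
  below-one : ∀ j → + 0 ℤ.≤ j → j ℤ.< + 1 → j ≡ + 0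
  below-one (+ zero)  _ _                  = refl
  below-one (+ suc n) _ (ℤ.+<+ (ℕ.s≤s ()))
  below-one -[1+ n ]  () _

IsSign : ℚ → Set
IsSign σ = σ ≡ 1ℚ ⊎ σ ≡ - 1ℚ

sign-neg : ∀ {σ} → IsSign σ → IsSign (- σ)
sign-neg (inj₁ refl) = inj₂ refl
sign-neg (inj₂ refl) = inj₁ refl

sign-square : ∀ {σ} → IsSign σ → σ * σ ≡ 1ℚ
sign-square (inj₁ refl) = refl
sign-square (inj₂ refl) = refl

sign-≢0 : ∀ {σ} → IsSign σ → σ ≢ 0ℚ
sign-≢0 (inj₁ refl) ()
sign-≢0 (inj₂ refl) ()

sign-ι : ∀ {σ} → IsSign σ → ∃[ i ] σ ≡ ι i
sign-ι (inj₁ refl) = + 1 , refl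
sign-ι (inj₂ refl) = -[1+ 0 ] , refl

ι-sign-abs : ∀ i → ∃[ σ ] (IsSign σ × ι i ≡ σ * ℕ→ℚ ℤ.∣ i ∣)
ι-sign-abs (+ n)    = 1ℚ , inj₁ refl , sym (ℚP.*-identityˡ _)
ι-sign-abs -[1+ n ] = - 1ℚ , inj₂ refl , neg-as-* (ℕ→ℚ (suc n))

abs-numerator-sign : ∀ {σ} → IsSign σ → ∀ u → ℤ.∣ ↥ (σ * u) ∣ ≡ ℤ.∣ ↥ u ∣
abs-numerator-sign (inj₁ refl) u = cong (λ r → ℤ.∣ ↥ r ∣) (ℚP.*-identityˡ u)
abs-numerator-sign (inj₂ refl) u = trans (cong (λ r → ℤ.∣ ↥ r ∣) (sym (neg-as-* u)))
  (trans (cong ℤ.∣_∣ (ℚP.↥-neg u)) (ℤP.∣-i∣≡∣i∣ (↥ u)))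

denominator-sign : ∀ {σ} → IsSign σ → ∀ u → ↧ₙ (σ * u) ≡ ↧ₙ u
denominator-sign (inj₁ refl) u = cong ↧ₙ_ (ℚP.*-identityˡ u)
denominator-sign (inj₂ refl) u = trans (cong ↧ₙ_ (sym (neg-as-* u))) (cong ℤ.∣_∣ (ℚP.↧-neg u))

UnitFraction : ℚ → ℕ → Set
UnitFraction t D = ∃[ σ ] (IsSign σ × t * ℕ→ℚ D ≡ σ)

unitFraction-num : ∀ u c → c * ℕ→ℚ ℤ.∣ ↥ u ∣ ≡ 1ℚ → UnitFraction (u * c) (↧ₙ u)
unitFraction-num u c c*num≡1 with ι-sign-abs (↥ u)
... | σ , sσ , num≡ = σ , sσ , (begin
  u * c * ℕ→ℚ (↧ₙ u)             ≡⟨ solve 3 (λ u c d → u :* c :* d := c :* (u :* d)) refl u c (ℕ→ℚ (↧ₙ u)) ⟩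
  c * (u * ι (↧ u))              ≡⟨ cong (c *_) (trans (clear-denominator u) num≡) ⟩
  c * (σ * ℕ→ℚ ℤ.∣ ↥ u ∣)        ≡⟨ solve 3 (λ c s n → c :* (s :* n) := s :* (c :* n)) refl c σ (ℕ→ℚ ℤ.∣ ↥ u ∣) ⟩
  σ * (c * ℕ→ℚ ℤ.∣ ↥ u ∣)        ≡⟨ cong (σ *_) c*num≡1 ⟩
  σ * 1ℚ                         ≡⟨ ℚP.*-identityʳ σ ⟩
  σ                              ∎)
  where open ≡-Reasoning

unitFraction-value : ∀ {t σ} D → t * ℕ→ℚ (suc D) ≡ σ → t ≡ σ * (+ 1 ℚ./ suc D)
unitFraction-value {t} {σ} D t*D≡σ = begin
  t                                        ≡⟨ sym (ℚP.*-identityʳ t) ⟩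
  t * 1ℚ                                   ≡⟨ cong (t *_) (sym (ℕ→ℚ-inverse (suc D))) ⟩
  t * (ℕ→ℚ (suc D) * (+ 1 ℚ./ suc D))      ≡⟨ sym (ℚP.*-assoc t _ _) ⟩
  t * ℕ→ℚ (suc D) * (+ 1 ℚ./ suc D)        ≡⟨ cong (_* (+ 1 ℚ./ suc D)) t*D≡σ ⟩
  σ * (+ 1 ℚ./ suc D)                      ∎
  where open ≡-Reasoning

unitFraction-≢0 : ∀ {t D} → UnitFraction t D → t ≢ 0ℚ
unitFraction-≢0 {t} {D} (σ , sσ , t*D≡σ) t≡0 = sign-≢0 sσ
  (trans (sym t*D≡σ) (trans (cong (_* ℕ→ℚ D) t≡0) (ℚP.*-zeroˡ (ℕ→ℚ D))))

finite-range-repeats : ∀ {A : Set} M (enum : Fin M → A) (y : ℕ → A)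
                     → (∀ n → ∃[ i ] y n ≡ enum i) → ∃[ m₁ ] ∃[ m₂ ] (m₁ < m₂ × y m₁ ≡ y m₂)
finite-range-repeats M enum y covered = repeat (FinP.pigeonhole (ℕP.n<1+n M) code)
  where
  code : Fin (suc M) → Fin M
  code i = proj₁ (covered (toℕ i))
  repeat : ∃[ i ] ∃[ j ] (i Fin.< j × code i ≡ code j) → ∃[ m₁ ] ∃[ m₂ ] (m₁ < m₂ × y m₁ ≡ y m₂)
  repeat (i , j , i<j , same) = toℕ i , toℕ j , i<j ,
    trans (proj₂ (covered (toℕ i))) (trans (cong enum same) (sym (proj₂ (covered (toℕ j)))))

sign : Fin 2 → ℚ
sign Fin.zero    = 1ℚ
sign (Fin.suc _) = - 1ℚ

unitPoint : ∀ N → Fin (2 ℕ.* N) → K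
unitPoint N i = (0ℚ , sign (proj₁ (remQuot {2} N i)) * (+ 1 ℚ./ suc (toℕ (proj₂ (remQuot {2} N i)))))

unitPoint-complete : ∀ N {t D} → UnitFraction t (suc D) → suc D ≤ N → ∃[ i ] (0ℚ , t) ≡ unitPoint N i
unitPoint-complete N {t} {D} (σ , sσ , t*D≡σ) D<N = combine (bit sσ) j , (begin
  (0ℚ , t)                                          ≡⟨ cong (0ℚ ,_) (unitFraction-value D t*D≡σ) ⟩
  (0ℚ , σ * (+ 1 ℚ./ suc D))                        ≡⟨ cong₂ (λ s D′ → (0ℚ , s * (+ 1 ℚ./ suc D′))) (sign-bit sσ) (sym (FinP.toℕ-fromℕ< D<N)) ⟩
  (0ℚ , sign (bit sσ) * (+ 1 ℚ./ suc (toℕ j)))      ≡⟨ sym (cong (λ bD → (0ℚ , sign (proj₁ bD) * (+ 1 ℚ./ suc (toℕ (proj₂ bD))))) (FinP.remQuot-combine {2} {N} (bit sσ) j)) ⟩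
  unitPoint N (combine (bit sσ) j)                  ∎)
  where
  open ≡-Reasoning
  j = fromℕ< D<N
  bit : ∀ {σ} → IsSign σ → Fin 2
  bit (inj₁ _) = Fin.zero
  bit (inj₂ _) = Fin.suc Fin.zero
  sign-bit : ∀ {σ} (sσ : IsSign σ) → σ ≡ sign (bit sσ)
  sign-bit (inj₁ refl) = refl
  sign-bit (inj₂ refl) = refl

-- Rationals integral at a prime p, and the ideal pℤ_(p).
module Integrality (p : ℕ) (pr : Prime p) where

  private instance
    p≢0 : NonZero p
    p≢0 = prime⇒nonZero pr

  Integral : ℚ → Set
  Integral r = ¬ p ∣ ↧ₙ r

  p∤1 : ¬ p ∣ 1
  p∤1 p∣1 = ℕP.<-irrefl (sym (∣1⇒≡1 p∣1)) (ℕ.nonTrivial⇒n>1 p {{prime⇒nonTrivial pr}})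

  p∤* : ∀ {m n} → ¬ p ∣ m → ¬ p ∣ n → ¬ p ∣ m ℕ.* n
  p∤* {m} {n} p∤m p∤n p∣mn = [ p∤m , p∤n ]′ (euclidsLemma m n pr p∣mn)

  ∤⇒coprime : ∀ {n} → ¬ p ∣ n → Coprime n p
  ∤⇒coprime p∤n {i} (i∣n , i∣p) with prime⇒irreducible pr i∣p
  ... | inj₁ i≡1 = i≡1
  ... | inj₂ refl = ⊥-elim (p∤n i∣n)

  coprime⇒∤ : ∀ {m n} → Coprime m n → p ∣ m → ¬ p ∣ n
  coprime⇒∤ c p∣m p∣n = p∤1 (subst (p ∣_) (c (p∣m , p∣n)) ∣-refl)

  ∣-*-pow : ∀ k {D} m → ¬ p ∣ D → D ∣ m ℕ.* p ℕ.^ k → D ∣ m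
  ∣-*-pow zero    {D} m _   D∣ = subst (D ∣_) (ℕP.*-identityʳ m) D∣
  ∣-*-pow (suc k) {D} m p∤D D∣ = ∣-*-pow k m p∤D (coprime-divisor (∤⇒coprime p∤D)
    (subst (D ∣_) reassoc D∣))
    where
    reassoc : m ℕ.* (p ℕ.* p ℕ.^ k) ≡ p ℕ.* (m ℕ.* p ℕ.^ k)
    reassoc = trans (sym (ℕP.*-assoc m p (p ℕ.^ k)))
      (trans (cong (ℕ._* p ℕ.^ k) (ℕP.*-comm m p)) (ℕP.*-assoc p m (p ℕ.^ k)))

  integral-if-cleared : ∀ r b a → r * ι b ≡ ι a → ¬ p ∣ ℤ.∣ b ∣ → Integral r
  integral-if-cleared r b a e p∤b p∣r = p∤b (∣-trans p∣r (denominator-∣ r b a e))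

  ι-integral : ∀ a → Integral (ι a)
  ι-integral a p∣ = p∤1 (subst (p ∣_) (cong ℤ.∣_∣ (↧-ι a)) p∣)

  *-integral : ∀ r s → Integral r → Integral s → Integral (r * s)
  *-integral r s ir is = integral-if-cleared (r * s) (↧ r ℤ.* ↧ s) (↥ r ℤ.* ↥ s) cleared
    (subst (λ n → ¬ p ∣ n) (sym (ℤP.abs-* (↧ r) (↧ s))) (p∤* ir is))
    where
    cleared : r * s * ι (↧ r ℤ.* ↧ s) ≡ ι (↥ r ℤ.* ↥ s)
    cleared = begin
      r * s * ι (↧ r ℤ.* ↧ s)           ≡⟨ cong (r * s *_) (ι-* (↧ r) (↧ s)) ⟩
      r * s * (ι (↧ r) * ι (↧ s))       ≡⟨ solve 4 (λ r s x y → r :* s :* (x :* y) := (r :* x) :* (s :* y)) refl r s (ι (↧ r)) (ι (↧ s)) ⟩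
      r * ι (↧ r) * (s * ι (↧ s))       ≡⟨ cong₂ _*_ (clear-denominator r) (clear-denominator s) ⟩
      ι (↥ r) * ι (↥ s)                 ≡⟨ sym (ι-* (↥ r) (↥ s)) ⟩
      ι (↥ r ℤ.* ↥ s)                   ∎
      where open ≡-Reasoning

  +-integral : ∀ r s → Integral r → Integral s → Integral (r + s)
  +-integral r s ir is = integral-if-cleared (r + s) (↧ r ℤ.* ↧ s) (↥ r ℤ.* ↧ s ℤ.+ ↥ s ℤ.* ↧ r) cleared
    (subst (λ n → ¬ p ∣ n) (sym (ℤP.abs-* (↧ r) (↧ s))) (p∤* ir is))
    where
    cleared : (r + s) * ι (↧ r ℤ.* ↧ s) ≡ ι (↥ r ℤ.* ↧ s ℤ.+ ↥ s ℤ.* ↧ r)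
    cleared = begin
      (r + s) * ι (↧ r ℤ.* ↧ s)                         ≡⟨ cong ((r + s) *_) (ι-* (↧ r) (↧ s)) ⟩
      (r + s) * (ι (↧ r) * ι (↧ s))                     ≡⟨ solve 4 (λ r s x y → (r :+ s) :* (x :* y) := (r :* x) :* y :+ (s :* y) :* x) refl r s (ι (↧ r)) (ι (↧ s)) ⟩
      r * ι (↧ r) * ι (↧ s) + s * ι (↧ s) * ι (↧ r)     ≡⟨ cong₂ (λ a b → a * ι (↧ s) + b * ι (↧ r)) (clear-denominator r) (clear-denominator s) ⟩
      ι (↥ r) * ι (↧ s) + ι (↥ s) * ι (↧ r)             ≡⟨ sym (cong₂ _+_ (ι-* (↥ r) (↧ s)) (ι-* (↥ s) (↧ r))) ⟩
      ι (↥ r ℤ.* ↧ s) + ι (↥ s ℤ.* ↧ r)                 ≡⟨ sym (ι-+ (↥ r ℤ.* ↧ s) (↥ s ℤ.* ↧ r)) ⟩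
      ι (↥ r ℤ.* ↧ s ℤ.+ ↥ s ℤ.* ↧ r)                   ∎
      where open ≡-Reasoning

  neg-integral : ∀ r → Integral r → Integral (- r)
  neg-integral r ir = subst Integral (sym (neg-as-* r)) (*-integral (ι -[1+ 0 ]) r (ι-integral -[1+ 0 ]) ir)

  -‿integral : ∀ r s → Integral r → Integral s → Integral (r - s)
  -‿integral r s ir is = +-integral r (- s) ir (neg-integral s is)

  integral-cancel : ∀ w c → Integral (w * c) → ¬ p ∣ ℤ.∣ ↥ c ∣ → Integral w
  integral-cancel w c iwc p∤c = integral-if-cleared w (↥ c ℤ.* ↧ (w * c)) (↥ (w * c) ℤ.* ↧ c) cleared
    (subst (λ n → ¬ p ∣ n) (sym (ℤP.abs-* (↥ c) (↧ (w * c)))) (p∤* p∤c iwc))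
    where
    cleared : w * ι (↥ c ℤ.* ↧ (w * c)) ≡ ι (↥ (w * c) ℤ.* ↧ c)
    cleared = begin
      w * ι (↥ c ℤ.* ↧ (w * c))                 ≡⟨ cong (w *_) (ι-* (↥ c) (↧ (w * c))) ⟩
      w * (ι (↥ c) * ι (↧ (w * c)))             ≡⟨ cong (λ n → w * (n * ι (↧ (w * c)))) (sym (clear-denominator c)) ⟩
      w * (c * ι (↧ c) * ι (↧ (w * c)))         ≡⟨ solve 4 (λ w c a b → w :* (c :* a :* b) := (w :* c) :* b :* a) refl w c (ι (↧ c)) (ι (↧ (w * c))) ⟩
      w * c * ι (↧ (w * c)) * ι (↧ c)           ≡⟨ cong (_* ι (↧ c)) (clear-denominator (w * c)) ⟩
      ι (↥ (w * c)) * ι (↧ c)                   ≡⟨ sym (ι-* (↥ (w * c)) (↧ c)) ⟩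
      ι (↥ (w * c) ℤ.* ↧ c)                     ∎
      where open ≡-Reasoning

  -- 1/p, definitionally the same as PAdic.pPow -[1+ 0 ]
  p⁻¹ : ℚ
  p⁻¹ = (+ 1 ℚ./ (p ℕ.^ 1)) {{ℕP.m^n≢0 p 1}}

  p*p⁻¹ : ℕ→ℚ p * p⁻¹ ≡ 1ℚ
  p*p⁻¹ = trans (cong (λ n → ℕ→ℚ n * p⁻¹) (sym (ℕP.*-identityʳ p))) (ℕ→ℚ-inverse (p ℕ.^ 1) {{ℕP.m^n≢0 p 1}})

  x/p*p≡x : ∀ x → x * p⁻¹ * ℕ→ℚ p ≡ x
  x/p*p≡x x = trans (ℚP.*-assoc x p⁻¹ (ℕ→ℚ p))
    (trans (cong (x *_) (trans (ℚP.*-comm p⁻¹ (ℕ→ℚ p)) p*p⁻¹)) (ℚP.*-identityʳ x))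

  InPZ : ℚ → Set
  InPZ r = Integral (r * p⁻¹)

  +-InPZ : ∀ x y → InPZ x → InPZ y → InPZ (x + y)
  +-InPZ x y px py = subst Integral (sym (ℚP.*-distribʳ-+ p⁻¹ x y)) (+-integral (x * p⁻¹) (y * p⁻¹) px py)

  neg-InPZ : ∀ x → InPZ x → InPZ (- x)
  neg-InPZ x px = subst Integral (ℚP.neg-distribˡ-* x p⁻¹) (neg-integral (x * p⁻¹) px)

  -‿InPZ : ∀ x y → InPZ x → InPZ y → InPZ (x - y)
  -‿InPZ x y px py = +-InPZ x (- y) px (neg-InPZ y py)

  *-InPZ : ∀ y x → Integral y → InPZ x → InPZ (y * x)
  *-InPZ y x iy px = subst Integral (sym (ℚP.*-assoc y x p⁻¹)) (*-integral y (x * p⁻¹) iy px)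

  InPZ⇒Integral : ∀ x → InPZ x → Integral x
  InPZ⇒Integral x px = subst Integral (x/p*p≡x x) (*-integral (x * p⁻¹) (ℕ→ℚ p) px (ι-integral (+ p)))

  ℕ-InPZ : ∀ n → p ∣ n → InPZ (ℕ→ℚ n)
  ℕ-InPZ n (divides j refl) = subst Integral (sym jp/p≡j) (ι-integral (+ j))
    where
    jp/p≡j : ℕ→ℚ (j ℕ.* p) * p⁻¹ ≡ ℕ→ℚ j
    jp/p≡j = trans (cong (_* p⁻¹) (ℕ→ℚ-* j p))
      (trans (ℚP.*-assoc (ℕ→ℚ j) (ℕ→ℚ p) p⁻¹) (trans (cong (ℕ→ℚ j *_) p*p⁻¹) (ℚP.*-identityʳ _)))

  ℤ-InPZ : ∀ i → p ∣ ℤ.∣ i ∣ → InPZ (ι i)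
  ℤ-InPZ (+ n)    p∣n = ℕ-InPZ n p∣n
  ℤ-InPZ -[1+ n ] p∣n = neg-InPZ (ℕ→ℚ (suc n)) (ℕ-InPZ (suc n) p∣n)

  InPZ-ℕ : ∀ n → InPZ (ℕ→ℚ n) → p ∣ n
  InPZ-ℕ n pn = [ (λ p∣n → p∣n) , (λ p∣w → ⊥-elim (pn p∣w)) ]′ (euclidsLemma n (↧ₙ w) pr (divides ℤ.∣ ↥ w ∣ abs-eq))
    where
    w = ℕ→ℚ n * p⁻¹
    cleared : ℕ→ℚ n * ι (↧ w) ≡ ι (↥ w ℤ.* + p)
    cleared = begin
      ℕ→ℚ n * ι (↧ w)                 ≡⟨ cong (_* ι (↧ w)) (sym (x/p*p≡x (ℕ→ℚ n))) ⟩
      w * ℕ→ℚ p * ι (↧ w)             ≡⟨ solve 3 (λ w a d → w :* a :* d := w :* d :* a) refl w (ℕ→ℚ p) (ι (↧ w)) ⟩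
      w * ι (↧ w) * ℕ→ℚ p             ≡⟨ cong (_* ℕ→ℚ p) (clear-denominator w) ⟩
      ι (↥ w) * ι (+ p)               ≡⟨ sym (ι-* (↥ w) (+ p)) ⟩
      ι (↥ w ℤ.* + p)                 ∎
      where open ≡-Reasoning
    int-eq : + n ℤ.* ↧ w ≡ ↥ w ℤ.* + p
    int-eq = ι-injective (+ n ℤ.* ↧ w) (↥ w ℤ.* + p) (trans (ι-* (+ n) (↧ w)) cleared)
    abs-eq : n ℕ.* ↧ₙ w ≡ ℤ.∣ ↥ w ∣ ℕ.* p
    abs-eq = trans (sym (ℤP.abs-* (+ n) (↧ w))) (trans (cong ℤ.∣_∣ int-eq) (ℤP.abs-* (↥ w) (+ p)))

  InPZ-cancel : ∀ x y → InPZ (x * y) → ¬ p ∣ ℤ.∣ ↥ y ∣ → InPZ x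
  InPZ-cancel x y pxy p∤y = integral-cancel (x * p⁻¹) y
    (subst Integral (solve 3 (λ x y q → x :* y :* q := x :* q :* y) refl x y p⁻¹) pxy) p∤y

  unit-numerator : ∀ y → Integral y → ¬ InPZ y → ¬ p ∣ ℤ.∣ ↥ y ∣
  unit-numerator y iy ¬py p∣y = ¬py (integral-cancel (y * p⁻¹) (ι (↧ y)) y/p*den p∤den)
    where
    y/p*den : Integral (y * p⁻¹ * ι (↧ y))
    y/p*den = subst Integral
      (sym (trans (solve 3 (λ y a b → y :* a :* b := y :* b :* a) refl y p⁻¹ (ι (↧ y)))
                  (cong (_* p⁻¹) (clear-denominator y))))
      (ℤ-InPZ (↥ y) p∣y)
    p∤den : ¬ p ∣ ℤ.∣ ↥ ι (↧ y) ∣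
    p∤den = subst (λ i → ¬ p ∣ ℤ.∣ i ∣) (sym (↥-ι (↧ y))) iy

  inverse-times-numerator : ∀ u v → u * v ≡ 1ℚ → v * ι (↥ u) ≡ ι (↧ u)
  inverse-times-numerator u v uv≡1 = begin
    v * ι (↥ u)         ≡⟨ cong (v *_) (sym (clear-denominator u)) ⟩
    v * (u * ι (↧ u))   ≡⟨ solve 3 (λ v u a → v :* (u :* a) := (u :* v) :* a) refl v u (ι (↧ u)) ⟩
    u * v * ι (↧ u)     ≡⟨ cong (_* ι (↧ u)) uv≡1 ⟩
    1ℚ * ι (↧ u)        ≡⟨ ℚP.*-identityˡ _ ⟩
    ι (↧ u)             ∎
    where open ≡-Reasoning

  inverse-integral : ∀ u v → u * v ≡ 1ℚ → Integral v → ¬ InPZ v → Integral u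
  inverse-integral u v uv≡1 iv ¬pv p∣den = ¬pv (InPZ-cancel v (ι (↥ u))
    (subst InPZ (sym (inverse-times-numerator u v uv≡1)) (ℕ-InPZ (↧ₙ u) p∣den))
    (subst (λ i → ¬ p ∣ ℤ.∣ i ∣) (sym (↥-ι (↥ u))) (coprime⇒∤ (Coprimality.sym (numerator-coprime u)) p∣den)))

  inverse-numerator : ∀ u v → u * v ≡ 1ℚ → Integral v → ¬ p ∣ ℤ.∣ ↥ u ∣
  inverse-numerator u v uv≡1 iv p∣num = coprime⇒∤ (numerator-coprime u) p∣num (InPZ-ℕ (↧ₙ u)
    (subst InPZ (inverse-times-numerator u v uv≡1) (*-InPZ v (ι (↥ u)) iv (ℤ-InPZ (↥ u) p∣num))))

  integral-denominator-∣ : ∀ r b k c → Integral r → r * ι b * ℕ→ℚ (p ℕ.^ k) ≡ ι c → ↧ₙ r ∣ ℤ.∣ b ∣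
  integral-denominator-∣ r b k c ir cleared = ∣-*-pow k ℤ.∣ b ∣ ir
    (subst (↧ₙ r ∣_) (ℤP.abs-* b (+ (p ℕ.^ k))) (denominator-∣ r (b ℤ.* + (p ℕ.^ k)) c cleared′))
    where
    cleared′ : r * ι (b ℤ.* + (p ℕ.^ k)) ≡ ι c
    cleared′ = trans (cong (r *_) (ι-* b (+ (p ℕ.^ k))))
      (trans (sym (ℚP.*-assoc r (ι b) (ℕ→ℚ (p ℕ.^ k)))) cleared)

-- The map T for z with minimal polynomial x² + a₁ x + a₂ and p-adic digits d.
module Quadratic (p : ℕ) (pr : Prime p) (a₁ a₂ : ℚ) (d : ℕ → ℕ) (ε : ℚ) where
  open PAdic p pr a₁ a₂ d ε
  open Integrality p pr

  private instance
    p≢0 : NonZero p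
    p≢0 = prime⇒nonZero pr

  P : ℚ
  P = ℕ→ℚ p

  ℕ→ℚ-p^suc : ∀ m → ℕ→ℚ (p ℕ.^ suc m) ≡ ℕ→ℚ (p ℕ.^ m) * P
  ℕ→ℚ-p^suc m = trans (cong ℕ→ℚ (ℕP.*-comm p (p ℕ.^ m))) (ℕ→ℚ-* (p ℕ.^ m) p)

  p^-k*p^k : ∀ k → pPow (ℤ.- (+ k)) * ℕ→ℚ (p ℕ.^ k) ≡ 1ℚ
  p^-k*p^k zero    = refl
  p^-k*p^k (suc k) = trans (ℚP.*-comm (pPow -[1+ k ]) (ℕ→ℚ (p ℕ.^ suc k)))
    (ℕ→ℚ-inverse (p ℕ.^ suc k) {{ℕP.m^n≢0 p (suc k)}})

  p^v*p^-v : ∀ v → pPow v * pPow (ℤ.- v) ≡ 1ℚ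
  p^v*p^-v (+ zero)  = refl
  p^v*p^-v (+ suc n) = ℕ→ℚ-inverse (p ℕ.^ suc n) {{ℕP.m^n≢0 p (suc n)}}
  p^v*p^-v -[1+ n ]  = p^-k*p^k (suc n)

  p^-[v+1] : ∀ v → pPow (ℤ.- (v ℤ.+ + 1)) ≡ pPow (ℤ.- v) * p⁻¹
  p^-[v+1] (+ zero)    = sym (ℚP.*-identityˡ p⁻¹)
  p^-[v+1] (+ suc n) rewrite ℕP.+-comm n 1 =
    inverse-unique (pPow -[1+ suc n ]) (pPow -[1+ n ] * p⁻¹) (ℕ→ℚ (p ℕ.^ suc (suc n)))
      (p^-k*p^k (suc (suc n))) inverse
    where
    inverse : pPow -[1+ n ] * p⁻¹ * ℕ→ℚ (p ℕ.^ suc (suc n)) ≡ 1ℚ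
    inverse = begin
      pPow -[1+ n ] * p⁻¹ * ℕ→ℚ (p ℕ.^ suc (suc n))
        ≡⟨ cong (pPow -[1+ n ] * p⁻¹ *_) (ℕ→ℚ-p^suc (suc n)) ⟩
      pPow -[1+ n ] * p⁻¹ * (ℕ→ℚ (p ℕ.^ suc n) * P)
        ≡⟨ solve 4 (λ a b c e → a :* b :* (c :* e) := (a :* c) :* (e :* b)) refl (pPow -[1+ n ]) p⁻¹ (ℕ→ℚ (p ℕ.^ suc n)) P ⟩
      pPow -[1+ n ] * ℕ→ℚ (p ℕ.^ suc n) * (P * p⁻¹)
        ≡⟨ cong₂ _*_ (p^-k*p^k (suc n)) p*p⁻¹ ⟩
      1ℚ ∎
      where open ≡-Reasoning
  p^-[v+1] -[1+ zero ]  = sym (trans (cong (_* p⁻¹) (cong ℕ→ℚ (ℕP.*-identityʳ p))) p*p⁻¹)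
  p^-[v+1] -[1+ suc m ] = sym (begin
    ℕ→ℚ (p ℕ.^ suc (suc m)) * p⁻¹   ≡⟨ cong (_* p⁻¹) (ℕ→ℚ-p^suc (suc m)) ⟩
    ℕ→ℚ (p ℕ.^ suc m) * P * p⁻¹     ≡⟨ ℚP.*-assoc (ℕ→ℚ (p ℕ.^ suc m)) P p⁻¹ ⟩
    ℕ→ℚ (p ℕ.^ suc m) * (P * p⁻¹)   ≡⟨ cong (ℕ→ℚ (p ℕ.^ suc m) *_) p*p⁻¹ ⟩
    ℕ→ℚ (p ℕ.^ suc m) * 1ℚ          ≡⟨ ℚP.*-identityʳ _ ⟩
    ℕ→ℚ (p ℕ.^ suc m)               ∎)
    where open ≡-Reasoning

  p-part : ∀ n → Acc ℕ._<_ n → {{NonZero n}} → ∃[ e ] ∃[ m ] (n ≡ p ℕ.^ e ℕ.* m × ¬ p ∣ m)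
  p-part n (acc smaller) with p ∣? n
  ... | no p∤n = 0 , n , sym (ℕP.+-identityʳ n) , p∤n
  ... | yes (divides q refl) with p-part q (smaller q<qp) {{q≢0}}
    where
    q≢0 : NonZero q
    q≢0 = ℕP.m*n≢0⇒m≢0 q
    q<qp : q ℕ.< q ℕ.* p
    q<qp = ℕP.m<m*n q p {{q≢0}} (ℕ.nonTrivial⇒n>1 p {{prime⇒nonTrivial pr}})
  ...   | e , m , refl , p∤m = suc e , m , reassoc , p∤m
    where
    reassoc : p ℕ.^ e ℕ.* m ℕ.* p ≡ p ℕ.* p ℕ.^ e ℕ.* m
    reassoc = trans (ℕP.*-comm (p ℕ.^ e ℕ.* m) p) (sym (ℕP.*-assoc p (p ℕ.^ e) m))

  eventually-integral : ∀ r → ∃[ M ] (∀ k → M ≤ k → Integral (r * ℕ→ℚ (p ℕ.^ k)))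
  eventually-integral r with p-part (↧ₙ r) (<-wellFounded (↧ₙ r))
  ... | e , m , den≡ , p∤m = e , integral
    where
    integral : ∀ k → e ≤ k → Integral (r * ℕ→ℚ (p ℕ.^ k))
    integral k e≤k = integral-if-cleared (r * ℕ→ℚ (p ℕ.^ k)) (+ m) (↥ r ℤ.* + (p ℕ.^ j)) cleared p∤m
      where
      j = k ℕ.∸ e
      split : ℕ→ℚ (p ℕ.^ k) ≡ ℕ→ℚ (p ℕ.^ e) * ℕ→ℚ (p ℕ.^ j)
      split = trans (cong (λ i → ℕ→ℚ (p ℕ.^ i)) (sym (ℕP.m+[n∸m]≡n e≤k)))
        (trans (cong ℕ→ℚ (ℕP.^-distribˡ-+-* p e j)) (ℕ→ℚ-* (p ℕ.^ e) (p ℕ.^ j)))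
      cleared : r * ℕ→ℚ (p ℕ.^ k) * ℕ→ℚ m ≡ ι (↥ r ℤ.* + (p ℕ.^ j))
      cleared = begin
        r * ℕ→ℚ (p ℕ.^ k) * ℕ→ℚ m
          ≡⟨ cong (λ y → r * y * ℕ→ℚ m) split ⟩
        r * (ℕ→ℚ (p ℕ.^ e) * ℕ→ℚ (p ℕ.^ j)) * ℕ→ℚ m
          ≡⟨ solve 4 (λ r a b c → r :* (a :* b) :* c := r :* (a :* c) :* b) refl r (ℕ→ℚ (p ℕ.^ e)) (ℕ→ℚ (p ℕ.^ j)) (ℕ→ℚ m) ⟩
        r * (ℕ→ℚ (p ℕ.^ e) * ℕ→ℚ m) * ℕ→ℚ (p ℕ.^ j)
          ≡⟨ cong (λ y → r * y * ℕ→ℚ (p ℕ.^ j)) (trans (sym (ℕ→ℚ-* (p ℕ.^ e) m)) (cong ℕ→ℚ (sym den≡))) ⟩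
        r * ι (↧ r) * ℕ→ℚ (p ℕ.^ j)
          ≡⟨ cong (_* ℕ→ℚ (p ℕ.^ j)) (clear-denominator r) ⟩
        ι (↥ r) * ι (+ (p ℕ.^ j))
          ≡⟨ sym (ι-* (↥ r) (+ (p ℕ.^ j))) ⟩
        ι (↥ r ℤ.* + (p ℕ.^ j)) ∎
        where open ≡-Reasoning

  zTrunc-divisible : d 0 ≡ 0 → ∀ k → p ∣ zTrunc k
  zTrunc-divisible d₀≡0 zero          = divides 0 refl
  zTrunc-divisible d₀≡0 (suc zero) rewrite d₀≡0 = divides 0 refl
  zTrunc-divisible d₀≡0 (suc (suc k)) = ∣m∣n⇒∣m+n (zTrunc-divisible d₀≡0 (suc k))
    (∣-trans (m∣m*n (p ℕ.^ k)) (n∣m*n (d (suc k))))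

  IsA'-unit : ∀ g a′ → g ≢ 0ℚ → ¬ p ∣ ℤ.∣ ↥ g ∣ → IsA' g a′ → a′ ≡ ℤ.∣ ↥ g ∣
  IsA'-unit g a′ g≢0 _   (inj₁ (g≡0 , _)) = ⊥-elim (g≢0 g≡0)
  IsA'-unit g a′ g≢0 p∤g (inj₂ (_ , _ , _ , a′∣g , maximal)) =
    ℕP.≤-antisym (∣⇒≤ {{ℕ.≢-nonZero num≢0}} a′∣g) (maximal _ (ℕP.n≢0⇒n>0 num≢0) (∤⇒coprime p∤g) ∣-refl)
    where
    num≢0 : ℤ.∣ ↥ g ∣ ≢ 0
    num≢0 num≡0 = g≢0 (ℚP.↥p≡0⇒p≡0 g (ℤP.∣i∣≡0⇒i≡0 num≡0))

  multiple-of-p-below : ∀ j → 0ℚ ℚ.≤ ι (j ℤ.* + p) → ι (j ℤ.* + p) ℚ.< P → j ≡ + 0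
  multiple-of-p-below j = subst (λ n → 0ℚ ℚ.≤ ι (j ℤ.* + n) → ι (j ℤ.* + n) ℚ.< ℕ→ℚ n → j ≡ + 0)
    (ℕP.suc-pred p) (multiple-below j (ℕ.pred p))

  -- The digit part s = x - ⟨x⟩_p of an element x ∈ pℤ_(p) is 0: s ∈ pℤ_(p) has
  -- p-power denominator, so it is an integer multiple of p, and 0 ≤ s < p.
  low-part-zero : ∀ x s → InPZ x → LowPart x s → s ≡ 0ℚ
  low-part-zero x s x∈pZ (0≤s , s<p , (e , den≡1) , x-s∈pZ) = trans s≡jp (cong (λ j → ι (j ℤ.* + p)) j≡0)
    where
    s∈pZ : InPZ s
    s∈pZ = subst InPZ (solve 2 (λ x s → x :- (x :- s) := s) refl x s) (-‿InPZ x (x - s) x∈pZ x-s∈pZ)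
    w = s * p⁻¹
    w-cleared : w * ι (+ 1) * ℕ→ℚ (p ℕ.^ suc e) ≡ ι (↥ (s * pPow (+ e)))
    w-cleared = begin
      w * ι (+ 1) * ℕ→ℚ (p ℕ.^ suc e)     ≡⟨ cong₂ _*_ (ℚP.*-identityʳ w) (ℕ→ℚ-p^suc e) ⟩
      s * p⁻¹ * (ℕ→ℚ (p ℕ.^ e) * P)       ≡⟨ solve 4 (λ s q a b → s :* q :* (a :* b) := s :* a :* (b :* q)) refl s p⁻¹ (ℕ→ℚ (p ℕ.^ e)) P ⟩
      s * ℕ→ℚ (p ℕ.^ e) * (P * p⁻¹)       ≡⟨ cong (s * ℕ→ℚ (p ℕ.^ e) *_) p*p⁻¹ ⟩
      s * ℕ→ℚ (p ℕ.^ e) * 1ℚ              ≡⟨ ℚP.*-identityʳ _ ⟩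
      s * pPow (+ e)                      ≡⟨ denominator-1 (s * pPow (+ e)) den≡1 ⟩
      ι (↥ (s * pPow (+ e)))              ∎
      where open ≡-Reasoning
    w≡j : w ≡ ι (↥ w)
    w≡j = denominator-1 w (∣1⇒≡1 (integral-denominator-∣ w (+ 1) (suc e) (↥ (s * pPow (+ e))) s∈pZ w-cleared))
    s≡jp : s ≡ ι (↥ w ℤ.* + p)
    s≡jp = trans (sym (x/p*p≡x s)) (trans (cong (_* P) w≡j) (sym (ι-* (↥ w) (+ p))))
    j≡0 : ↥ w ≡ + 0
    j≡0 = multiple-of-p-below (↥ w) (subst (0ℚ ℚ.≤_) s≡jp 0≤s) (subst (ℚ._< P) s≡jp s<p)

  zero-fixed : ∀ β → TRel 0K β → β ≡ 0K
  zero-fixed β (inj₁ (_ , β≡0)) = β≡0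
  zero-fixed β (inj₂ (0≢0 , _)) = ⊥-elim (0≢0 refl)

  sign-integral : ∀ {σ} → IsSign σ → Integral σ
  sign-integral sσ = subst Integral (sym (proj₂ (sign-ι sσ))) (ι-integral (proj₁ (sign-ι sσ)))

  -- Comparing constant coefficients in γ · (t z) = ε pᵛ, using z² = -a₁ z - a₂,
  -- gives U · (t a₂) = pᵛ for U = -ε γ₁.
  constant-coefficient : IsSign ε → ∀ γ₀ γ₁ t w → γ₀ * 0ℚ - γ₁ * t * a₂ ≡ ε * w → - (ε * γ₁) * (t * a₂) ≡ w
  constant-coefficient sε γ₀ γ₁ t w γα≡ = begin
    - (ε * γ₁) * (t * a₂)             ≡⟨ solve 5 (λ e g₀ g₁ t a → :- (e :* g₁) :* (t :* a) := e :* (g₀ :* con 0ℚ :- g₁ :* t :* a)) refl ε γ₀ γ₁ t a₂ ⟩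
    ε * (γ₀ * 0ℚ - γ₁ * t * a₂)       ≡⟨ cong (ε *_) γα≡ ⟩
    ε * (ε * w)                       ≡⟨ sym (ℚP.*-assoc ε ε w) ⟩
    ε * ε * w                         ≡⟨ cong (_* w) (sign-square sε) ⟩
    1ℚ * w                            ≡⟨ ℚP.*-identityˡ w ⟩
    w                                 ∎
    where open ≡-Reasoning

  -- If t = ±1/D₀ and U (t a₂) = pᵛ with U ∈ ℤ_(p), then den U divides num a₂:
  -- indeed U a₂ = ±D₀ pᵛ, and the denominator of U is prime to p.
  denominator-bound : ∀ t D₀ U v → UnitFraction t D₀ → U * (t * a₂) ≡ pPow v → Integral U
                    → ↧ₙ U ∣ ℤ.∣ ↥ a₂ ∣
  denominator-bound t D₀ U v (σ , sσ , tD≡σ) U-eq U-integral = by-cases v U-a₂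
    where
    i = proj₁ (sign-ι sσ)
    σ≡i = proj₂ (sign-ι sσ)
    c = σ * ℕ→ℚ D₀
    U-a₂ : U * ι (↥ a₂) ≡ c * pPow v * ι (↧ a₂)
    U-a₂ = begin
      U * ι (↥ a₂)                          ≡⟨ cong (U *_) (sym (clear-denominator a₂)) ⟩
      U * (a₂ * ι (↧ a₂))                   ≡⟨ sym (trans (cong (U * (a₂ * ι (↧ a₂)) *_) (sign-square sσ)) (ℚP.*-identityʳ _)) ⟩
      U * (a₂ * ι (↧ a₂)) * (σ * σ)         ≡⟨ cong (λ y → U * (a₂ * ι (↧ a₂)) * (σ * y)) (sym tD≡σ) ⟩
      U * (a₂ * ι (↧ a₂)) * (σ * (t * ℕ→ℚ D₀)) ≡⟨ solve 6 (λ u a b s t d → u :* (a :* b) :* (s :* (t :* d)) := s :* d :* (u :* (t :* a)) :* b) refl U a₂ (ι (↧ a₂)) σ t (ℕ→ℚ D₀) ⟩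
      c * (U * (t * a₂)) * ι (↧ a₂)         ≡⟨ cong (λ y → c * y * ι (↧ a₂)) U-eq ⟩
      c * pPow v * ι (↧ a₂)                 ∎
      where open ≡-Reasoning
    c≡ : c ≡ ι (i ℤ.* + D₀)
    c≡ = trans (cong (_* ℕ→ℚ D₀) σ≡i) (sym (ι-* i (+ D₀)))
    by-cases : ∀ v → U * ι (↥ a₂) ≡ c * pPow v * ι (↧ a₂) → ↧ₙ U ∣ ℤ.∣ ↥ a₂ ∣
    by-cases (+ n) e = integral-denominator-∣ U (↥ a₂) 0 (i ℤ.* + D₀ ℤ.* + (p ℕ.^ n) ℤ.* ↧ a₂) U-integral (begin
      U * ι (↥ a₂) * 1ℚ                                 ≡⟨ ℚP.*-identityʳ _ ⟩
      U * ι (↥ a₂)                                      ≡⟨ e ⟩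
      c * ℕ→ℚ (p ℕ.^ n) * ι (↧ a₂)                      ≡⟨ cong (λ y → y * ℕ→ℚ (p ℕ.^ n) * ι (↧ a₂)) c≡ ⟩
      ι (i ℤ.* + D₀) * ι (+ (p ℕ.^ n)) * ι (↧ a₂)       ≡⟨ cong (_* ι (↧ a₂)) (sym (ι-* (i ℤ.* + D₀) (+ (p ℕ.^ n)))) ⟩
      ι (i ℤ.* + D₀ ℤ.* + (p ℕ.^ n)) * ι (↧ a₂)         ≡⟨ sym (ι-* (i ℤ.* + D₀ ℤ.* + (p ℕ.^ n)) (↧ a₂)) ⟩
      ι (i ℤ.* + D₀ ℤ.* + (p ℕ.^ n) ℤ.* ↧ a₂)           ∎)
      where open ≡-Reasoning
    by-cases -[1+ n ] e = integral-denominator-∣ U (↥ a₂) (suc n) (i ℤ.* + D₀ ℤ.* ↧ a₂) U-integral (begin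
      U * ι (↥ a₂) * ℕ→ℚ (p ℕ.^ suc n)                  ≡⟨ cong (_* ℕ→ℚ (p ℕ.^ suc n)) e ⟩
      c * pPow -[1+ n ] * ι (↧ a₂) * ℕ→ℚ (p ℕ.^ suc n)  ≡⟨ solve 4 (λ c q a r → c :* q :* a :* r := c :* a :* (q :* r)) refl c (pPow -[1+ n ]) (ι (↧ a₂)) (ℕ→ℚ (p ℕ.^ suc n)) ⟩
      c * ι (↧ a₂) * (pPow -[1+ n ] * ℕ→ℚ (p ℕ.^ suc n)) ≡⟨ cong (c * ι (↧ a₂) *_) (p^-k*p^k (suc n)) ⟩
      c * ι (↧ a₂) * 1ℚ                                 ≡⟨ ℚP.*-identityʳ _ ⟩
      c * ι (↧ a₂)                                      ≡⟨ cong (_* ι (↧ a₂)) c≡ ⟩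
      ι (i ℤ.* + D₀) * ι (↧ a₂)                         ≡⟨ sym (ι-* (i ℤ.* + D₀) (↧ a₂)) ⟩
      ι (i ℤ.* + D₀ ℤ.* ↧ a₂)                           ∎)
      where open ≡-Reasoning

  Z : ℕ → ℚ
  Z k = ℕ→ℚ (zTrunc k)

  module _ (H : CondH) (R : RootDigits) where

    private
      a₁-integral   = proj₁ H
      a₁-not-InPZ   = proj₁ (proj₂ (proj₂ H))
      d₀≡0          = proj₁ (proj₂ R)
      root-digits   = proj₂ (proj₂ R)

    Z-InPZ : ∀ k → InPZ (Z k)
    Z-InPZ k = ℕ-InPZ (zTrunc k) (zTrunc-divisible d₀≡0 k)

    -- z_k + a₁ is a p-adic unit, because z_k ∈ pℤ and ord_p(a₁) = 0
    Z+a₁-integral : ∀ k → Integral (Z k + a₁)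
    Z+a₁-integral k = +-integral (Z k) a₁ (InPZ⇒Integral (Z k) (Z-InPZ k)) a₁-integral

    Z+a₁-not-InPZ : ∀ k → ¬ InPZ (Z k + a₁)
    Z+a₁-not-InPZ k inPZ = a₁-not-InPZ (subst InPZ (solve 2 (λ z a → z :+ a :- z := a) refl (Z k) a₁)
      (-‿InPZ (Z k + a₁) (Z k) inPZ (Z-InPZ k)))

    -- c · f(z_k) ∈ pℤ for k large, as f(z_k) ∈ pᵏℤ_(p)
    f-Z-small : ∀ c → ∃[ M ] (∀ k → M ≤ k → InPZ (c * f (Z k)))
    f-Z-small c = proj₁ c/p-eventually , λ k M≤k → subst Integral (rearrange k)
      (*-integral (f (Z k) * pPow (ℤ.- (+ k))) (c * p⁻¹ * ℕ→ℚ (p ℕ.^ k)) (root-digits k) (proj₂ c/p-eventually k M≤k))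
      where
      c/p-eventually = eventually-integral (c * p⁻¹)
      rearrange : ∀ k → f (Z k) * pPow (ℤ.- (+ k)) * (c * p⁻¹ * ℕ→ℚ (p ℕ.^ k)) ≡ c * f (Z k) * p⁻¹
      rearrange k = begin
        f (Z k) * pPow (ℤ.- (+ k)) * (c * p⁻¹ * ℕ→ℚ (p ℕ.^ k))
          ≡⟨ solve 5 (λ F a c q b → F :* a :* (c :* q :* b) := c :* F :* q :* (a :* b)) refl (f (Z k)) (pPow (ℤ.- (+ k))) c p⁻¹ (ℕ→ℚ (p ℕ.^ k)) ⟩
        c * f (Z k) * p⁻¹ * (pPow (ℤ.- (+ k)) * ℕ→ℚ (p ℕ.^ k))
          ≡⟨ cong (c * f (Z k) * p⁻¹ *_) (p^-k*p^k k) ⟩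
        c * f (Z k) * p⁻¹ * 1ℚ
          ≡⟨ ℚP.*-identityʳ _ ⟩
        c * f (Z k) * p⁻¹ ∎
        where open ≡-Reasoning

    -- ord_p(t a₂) = ord_p(t z) for t ∈ ℚ: if ord_p(t z) = v then t a₂ p⁻ᵛ is a
    -- p-adic unit.  This follows from z (z + a₁) = -a₂ with z + a₁ a unit.
    scaled-a₂-unit : ∀ t v → IsOrd (0ℚ , t) v
                   → Integral (t * a₂ * pPow (ℤ.- v)) × ¬ InPZ (t * a₂ * pPow (ℤ.- v))
    scaled-a₂-unit t v ((N , tz/pᵛ-integral) , ¬v+1) = V-integral , V-not-InPZ
      where
      q = pPow (ℤ.- v)
      V = t * a₂ * q
      W : ℕ → ℚ
      W k = (0ℚ + t * Z k) * q
      split : ∀ k → t * q * f (Z k) ≡ W k * (Z k + a₁) + V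
      split k = solve 5 (λ t q z a b → t :* q :* (z :* z :+ a :* z :+ b)
                                   := (con 0ℚ :+ t :* z) :* q :* (z :+ a) :+ t :* b :* q) refl t q (Z k) a₁ a₂
      k₁ = proj₁ (f-Z-small (t * q))
      f-small = proj₂ (f-Z-small (t * q))
      k₀ = N ℕ.⊔ k₁
      V≡ : ∀ k → t * q * f (Z k) - W k * (Z k + a₁) ≡ V
      V≡ k = trans (cong (_- W k * (Z k + a₁)) (split k))
        (solve 2 (λ a b → a :+ b :- a := b) refl (W k * (Z k + a₁)) V)
      V-integral : Integral V
      V-integral = subst Integral (V≡ k₀)
        (-‿integral (t * q * f (Z k₀)) (W k₀ * (Z k₀ + a₁)) (InPZ⇒Integral (t * q * f (Z k₀)) (f-small k₀ (ℕP.m≤n⊔m N k₁)))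
          (*-integral (W k₀) (Z k₀ + a₁) (tz/pᵛ-integral k₀ (ℕP.m≤m⊔n N k₁)) (Z+a₁-integral k₀)))
      V-not-InPZ : ¬ InPZ V
      V-not-InPZ V-InPZ = ¬v+1 (k₀ , λ k k₀≤k → W-small k (ℕP.≤-trans (ℕP.m≤n⊔m N k₁) k₀≤k))
        where
        W-small : ∀ k → k₁ ≤ k → InPQ (v ℤ.+ + 1) (approx (0ℚ , t) k)
        W-small k k₁≤k = subst Integral W/p≡ (InPZ-cancel (W k) (Z k + a₁) WY-small
          (unit-numerator (Z k + a₁) (Z+a₁-integral k) (Z+a₁-not-InPZ k)))
          where
          WY-small : InPZ (W k * (Z k + a₁))
          WY-small = subst InPZ (trans (cong (_- V) (split k)) (solve 2 (λ a b → a :+ b :- b := a) refl (W k * (Z k + a₁)) V))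
            (-‿InPZ (t * q * f (Z k)) V (f-small k k₁≤k) V-InPZ)
          W/p≡ : W k * p⁻¹ ≡ (0ℚ + t * Z k) * pPow (ℤ.- (v ℤ.+ + 1))
          W/p≡ = trans (ℚP.*-assoc (0ℚ + t * Z k) q p⁻¹) (cong ((0ℚ + t * Z k) *_) (sym (p^-[v+1] v)))

    -- if g₀ + g₁ z ∈ pℤ_p with g₁ ∈ ℤ_(p), then g₀ ∈ pℤ, since z ∈ pℤ_p
    constant-term-InPZ : ∀ g₀ g₁ → Integral g₁ → InP (+ 1) (g₀ , g₁) → InPZ g₀
    constant-term-InPZ g₀ g₁ g₁-integral (N , approx-InPZ) =
      subst InPZ (solve 2 (λ g w → g :+ w :- w := g) refl g₀ (g₁ * Z N))
        (-‿InPZ (g₀ + g₁ * Z N) (g₁ * Z N) (approx-InPZ N ℕP.≤-refl) (*-InPZ g₁ (Z N) g₁-integral (Z-InPZ N)))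

    AxisImage : ℚ → K → Set
    AxisImage t β = ∃[ t′ ] (β ≡ (0ℚ , t′)
                  × ∃[ U ] ∃[ v ] (U * (t * a₂) ≡ pPow v × Integral U × UnitFraction t′ (↧ₙ U)))

    -- T maps a nonzero point t z of the line ℚ z to a point ±z/D of the same line:
    -- with v = ord_p(t z), the number U = pᵛ/(t a₂) is a p-adic unit, the digit
    -- part of T vanishes, and T(t z) = (±U / |num U|) z = (±1 / den U) z.
    axis-step : IsSign ε → ∀ t → t ≢ 0ℚ → ∀ β → TRel (0ℚ , t) β → AxisImage t β
    axis-step sε t t≢0 β (inj₁ (α≡0 , _)) = ⊥-elim (t≢0 (cong proj₂ α≡0))
    axis-step sε t t≢0 β (inj₂ (_ , v , (γ₀ , γ₁) , c , a′ , ia , s , ord , γα≡ , (_ , digit)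
                                 , isA′ , ia*a′≡1 , low , β≡))
      = g₁ * ia , trans β≡ (cong (_, g₁ * ia) s≡0) , U , v , U-eq , U-integral , t′-unitFraction
      where
      U = - (ε * γ₁)
      U-eq : U * (t * a₂) ≡ pPow v
      U-eq = constant-coefficient sε γ₀ γ₁ t (pPow v) (cong proj₁ γα≡)
      V = t * a₂ * pPow (ℤ.- v)
      UV≡1 : U * V ≡ 1ℚ
      UV≡1 = trans (sym (ℚP.*-assoc U (t * a₂) (pPow (ℤ.- v)))) (trans (cong (_* pPow (ℤ.- v)) U-eq) (p^v*p^-v v))
      V-unit = scaled-a₂-unit t v ord
      U-integral = inverse-integral U V UV≡1 (proj₁ V-unit) (proj₂ V-unit)
      g₁ = γ₁ - 0ℚ
      -ε-sign = sign-neg sε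
      g₁≡ : g₁ ≡ - ε * U
      g₁≡ = trans (ℚP.+-identityʳ γ₁) (sym (trans (solve 2 (λ e g → :- e :* (:- (e :* g)) := e :* e :* g) refl ε γ₁)
                                               (trans (cong (_* γ₁) (sign-square sε)) (ℚP.*-identityˡ γ₁))))
      p∤g₁ : ¬ p ∣ ℤ.∣ ↥ g₁ ∣
      p∤g₁ = subst (λ n → ¬ p ∣ n) (sym (trans (cong (λ r → ℤ.∣ ↥ r ∣) g₁≡) (abs-numerator-sign -ε-sign U)))
               (inverse-numerator U V UV≡1 (proj₁ V-unit))
      g₁≢0 : g₁ ≢ 0ℚ
      g₁≢0 g₁≡0 = p∤g₁ (subst (λ r → p ∣ ℤ.∣ ↥ r ∣) (sym g₁≡0) (p ∣0))
      a′≡ = IsA'-unit g₁ a′ g₁≢0 p∤g₁ isA′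
      ia-integral : Integral ia
      ia-integral = integral-if-cleared ia (+ a′) (+ 1) ia*a′≡1 (subst (λ n → ¬ p ∣ n) (sym a′≡) p∤g₁)
      g₁-integral : Integral g₁
      g₁-integral = subst Integral (sym g₁≡) (*-integral (- ε) U (sign-integral -ε-sign) U-integral)
      s≡0 : s ≡ 0ℚ
      s≡0 = low-part-zero ((γ₀ - ℕ→ℚ c) * ia) s
        (subst InPZ (ℚP.*-comm ia (γ₀ - ℕ→ℚ c)) (*-InPZ ia (γ₀ - ℕ→ℚ c) ia-integral
          (constant-term-InPZ (γ₀ - ℕ→ℚ c) g₁ g₁-integral digit))) low
      t′-unitFraction : UnitFraction (g₁ * ia) (↧ₙ U)
      t′-unitFraction = subst (UnitFraction (g₁ * ia)) (trans (cong ↧ₙ_ g₁≡) (denominator-sign -ε-sign U))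
        (unitFraction-num g₁ ia (subst (λ n → ia * ℕ→ℚ n ≡ 1ℚ) a′≡ ia*a′≡1))

    -- a₂ = f(0) ≠ 0 since f has no rational root
    a₂≢0 : a₂ ≢ 0ℚ
    a₂≢0 a₂≡0 = proj₂ (proj₂ (proj₂ (proj₂ H))) 0ℚ
      (trans (solve 2 (λ a b → con 0ℚ :* con 0ℚ :+ a :* con 0ℚ :+ b := b) refl a₁ a₂) a₂≡0)

    module Orbit (sε : IsSign ε) (q : ℚ) (q≢0 : q ≢ 0ℚ) (x : ℕ → K) (x₀≡ : x 0 ≡ (0ℚ , q))
                 (T : ∀ n → TRel (x n) (x (suc n))) where

      OnAxis : K → Set
      OnAxis α = ∃[ t ] (α ≡ (0ℚ , t) × ∃[ D ] UnitFraction t D)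

      step-image : ∀ n t → x n ≡ (0ℚ , t) → t ≢ 0ℚ → AxisImage t (x (suc n))
      step-image n t x≡ t≢0 = axis-step sε t t≢0 (x (suc n)) (subst (λ α → TRel α (x (suc n))) x≡ (T n))

      forget : ∀ t α → AxisImage t α → OnAxis α
      forget t α (t′ , α≡ , U , _ , _ , _ , uf) = t′ , α≡ , ↧ₙ U , uf

      on-axis : ∀ n → OnAxis (x (suc n))
      on-axis zero    = forget q (x 1) (step-image 0 q x₀≡ q≢0)
      on-axis (suc n) = continue (on-axis n)
        where
        continue : OnAxis (x (suc n)) → OnAxis (x (2 ℕ.+ n))
        continue (t , x≡ , D , uf) = forget t (x (2 ℕ.+ n)) (step-image (suc n) t x≡ (unitFraction-≢0 {D = D} uf))

      -- num a₂ ≠ 0, so its divisors are at most |num a₂|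
      num≢0 : ℤ.∣ ↥ a₂ ∣ ≢ 0
      num≢0 num≡0 = a₂≢0 (ℚP.↥p≡0⇒p≡0 a₂ (ℤP.∣i∣≡0⇒i≡0 num≡0))

      in-finite-set : ∀ n → ∃[ i ] x (2 ℕ.+ n) ≡ unitPoint ℤ.∣ ↥ a₂ ∣ i
      in-finite-set n = second-step (on-axis n)
        where
        second-step : OnAxis (x (suc n)) → ∃[ i ] x (2 ℕ.+ n) ≡ unitPoint ℤ.∣ ↥ a₂ ∣ i
        second-step (t , x≡ , D₀ , uf) = bounded (step-image (suc n) t x≡ (unitFraction-≢0 {D = D₀} uf))
          where
          bounded : AxisImage t (x (2 ℕ.+ n)) → ∃[ i ] x (2 ℕ.+ n) ≡ unitPoint ℤ.∣ ↥ a₂ ∣ i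
          bounded (t′ , x′≡ , U , v , U-eq , U-integral , uf′) = proj₁ point , trans x′≡ (proj₂ point)
            where
            point = unitPoint-complete ℤ.∣ ↥ a₂ ∣ {D = ℚ.ℚ.denominator-1 U} uf′
              (∣⇒≤ {{ℕ.≢-nonZero num≢0}} (denominator-bound t D₀ U v uf U-eq U-integral))

lemma9 : (p : ℕ) (pr : Prime p) (a₁ a₂ : ℚ) (d : ℕ → ℕ) (ε : ℚ)
    → PAdic.CondH p pr a₁ a₂ d ε
    → PAdic.RootDigits p pr a₁ a₂ d ε
    → (ε ≡ 1ℚ ⊎ ε ≡ - 1ℚ)
    → (q : ℚ)
    → PAdic.InP p pr a₁ a₂ d ε (+ 1) (0ℚ , q)
    → (x : ℕ → K)
    → x 0 ≡ (0ℚ , q)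
    → (∀ n → PAdic.TRel p pr a₁ a₂ d ε (x n) (x (suc n)))
    → ∃[ m₁ ] ∃[ m₂ ] (m₁ < m₂ × x m₁ ≡ x m₂)
lemma9 p pr a₁ a₂ d ε H R sε q _ x x₀≡ T = by-cases (q ℚP.≟ 0ℚ)
  where
  open Quadratic p pr a₁ a₂ d ε using (zero-fixed; module Orbit)
  open PAdic p pr a₁ a₂ d ε using (TRel)
  Repeats : Set
  Repeats = ∃[ m₁ ] ∃[ m₂ ] (m₁ < m₂ × x m₁ ≡ x m₂)
  from-zero : q ≡ 0ℚ → Repeats
  from-zero q≡0 = 0 , 1 , ℕ.s≤s ℕ.z≤n , trans x₀≡0 (sym (zero-fixed (x 1) (subst (λ α → TRel α (x 1)) x₀≡0 (T 0))))
    where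
    x₀≡0 : x 0 ≡ 0K
    x₀≡0 = trans x₀≡ (cong (0ℚ ,_) q≡0)
  from-nonzero : q ≢ 0ℚ → Repeats
  from-nonzero q≢0 = shift (finite-range-repeats (2 ℕ.* ℤ.∣ ↥ a₂ ∣) (unitPoint ℤ.∣ ↥ a₂ ∣) (λ n → x (2 ℕ.+ n))
                                                   (Orbit.in-finite-set H R sε q q≢0 x x₀≡ T))
    where
    shift : ∃[ m₁ ] ∃[ m₂ ] (m₁ < m₂ × x (2 ℕ.+ m₁) ≡ x (2 ℕ.+ m₂)) → Repeats
    shift (m₁ , m₂ , m₁<m₂ , same) = 2 ℕ.+ m₁ , 2 ℕ.+ m₂ , ℕ.s≤s (ℕ.s≤s m₁<m₂) , same
  by-cases : Dec (q ≡ 0ℚ) → Repeats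
  by-cases (yes q≡0) = from-zero q≡0
  by-cases (no q≢0)  = from-nonzero q≢0
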